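{- Let $\Delta\ge 3$ be an integer and $0<\epsilon\le 1/\Delta^5$ a real number. Then there is $n_0=n_0(\Delta,\epsilon)$ such that the following holds for every $n\ge n_0$. Let $G_n$ be a graph on $n$ vertices with $\Delta(G_n)\le\Delta$, let $k=\chi(G_n)$, $\sigma=\sigma(G_n)$, and $N=(k-1)n+\sigma+\lceil \Delta^4\epsilon n\rceil$. Consider any red-blue edge-coloring of $K_N$ on vertex set $V$, with red graph $R$ and blue graph $B$, let $C^{(1)},C^{(2)},\dots$ be ordered disjoint longest cycles in $R$, let $r$ be the largest integer such that $C^{(1)},\dots,C^{(r)}$ all have length at least $\epsilon^2 n$, and let $W=V\setminus\bigcup_{j=1}^r V(C^{(j)})$. Then there is a subset $W'\subseteq W$ with $|W'|\ge(1-\epsilon)|W|$ such that every $\Delta$ vertices of $W'$ have at least $|W'|-\Delta\epsilon n$ common blue-neighbors in $W'$.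
   Context: $\chi(G)$ is the chromatic number and $\sigma(G)$ is the minimum size of a color class over all proper vertex-colorings of $G$ with $\chi(G)$ colors. Cycles $C^{(1)},C^{(2)},\dots$ are called ordered disjoint longest cycles in $R$ if, for each $i$, $C^{(i)}$ is a longest cycle in the graph $R\setminus\bigcup_{j<i}V(C^{(j)})$. A blue-neighbor of a vertex $v$ is a vertex joined to $v$ by a blue edge.
   Formalization: The parameter ε ranges over the rationals rather than the reals. -}

module Defs where

open import Data.Nat as ℕ using (ℕ; zero; suc; _∸_; _≤_)
open import Data.Integer as ℤ using (ℤ; +_)
open import Data.Rational as ℚ using (ℚ)
open import Data.Bool using (Bool; true; false; not; _∧_)
open import Data.Bool.ListAction using (any)
open import Data.Fin using (Fin; _≟_)
open import Data.Fin.Subset using (Subset; ∣_∣)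
open import Data.Vec using (tabulate; lookup; foldr)
open import Data.List using (List; []; _∷_; _++_; length; [_]; concat)
open import Data.List.Membership.Propositional using (_∉_)
open import Data.List.Relation.Unary.All using (All)
open import Data.List.Relation.Unary.Unique.Propositional using (Unique)
open import Data.Product using (_×_; Σ)
open import Data.Unit using (⊤)
open import Relation.Nullary using (¬_; ⌊_⌋)
open import Relation.Binary.PropositionalEquality using (_≡_; _≢_)

ℕ→ℚ : ℕ → ℚ
ℕ→ℚ n = + n ℚ./ 1

record Graph (n : ℕ) : Set where
  field
    adj   : Fin n → Fin n → Bool
    sym   : ∀ u v → adj u v ≡ adj v u
    irrefl : ∀ v → adj v v ≡ false
open Graph public

degree : ∀ {n} → Graph n → Fin n → ℕ
degree G v = ∣ tabulate (adj G v) ∣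

MaxDegreeAtMost : ∀ {n} → Graph n → ℕ → Set
MaxDegreeAtMost G d = ∀ v → degree G v ≤ d

ProperColouring : ∀ {n} → Graph n → (k : ℕ) → (Fin n → Fin k) → Set
ProperColouring G k c = ∀ u v → adj G u v ≡ true → c u ≢ c v

Colourable : ∀ {n} → Graph n → ℕ → Set
Colourable {n} G k = Σ (Fin n → Fin k) (ProperColouring G k)

IsChromaticNumber : ∀ {n} → Graph n → ℕ → Set
IsChromaticNumber G k = Colourable G k × (∀ j → Colourable G j → k ≤ j)

classSize : ∀ {n k} → (Fin n → Fin k) → Fin k → ℕ
classSize c i = ∣ tabulate (λ v → ⌊ c v ≟ i ⌋) ∣

IsSigma : ∀ {n} → Graph n → ℕ → ℕ → Set
IsSigma {n} G k s =
  (Σ (Fin n → Fin k) λ c → ProperColouring G k c × Σ (Fin k) λ i → classSize c i ≡ s)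
  × (∀ (c : Fin n → Fin k) → ProperColouring G k c → ∀ i → s ≤ classSize c i)

-- Red-blue edge colourings of K_N on Fin N (true = red, false = blue)

record EdgeColouring (N : ℕ) : Set where
  field
    col    : Fin N → Fin N → Bool
    colSym : ∀ u v → col u v ≡ col v u
open EdgeColouring public

Red : ∀ {N} → EdgeColouring N → Fin N → Fin N → Set
Red χ u v = u ≢ v × col χ u v ≡ true

Blue : ∀ {N} → EdgeColouring N → Fin N → Fin N → Set
Blue χ u v = u ≢ v × col χ u v ≡ false

-- Cycles, as lists of distinct vertices v₁ … v_m (m ≥ 3) with
-- v₁v₂, …, v_{m-1}v_m, v_m v₁ edges; length = number of vertices.

Path : ∀ {A : Set} → (A → A → Set) → List A → Set
Path E []           = ⊤
Path E (x ∷ [])     = ⊤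
Path E (x ∷ y ∷ xs) = E x y × Path E (y ∷ xs)

ClosedWalk : ∀ {A : Set} → (A → A → Set) → List A → Set
ClosedWalk E []       = ⊤
ClosedWalk E (x ∷ xs) = Path E ((x ∷ xs) ++ [ x ])

IsCycleIn : ∀ {A : Set} → (A → Set) → (A → A → Set) → List A → Set
IsCycleIn S E C = 3 ≤ length C × Unique C × All S C × ClosedWalk E C

IsLongestCycleIn : ∀ {A : Set} → (A → Set) → (A → A → Set) → List A → Set
IsLongestCycleIn S E C =
  IsCycleIn S E C × (∀ D → IsCycleIn S E D → length D ≤ length C)

OrderedDLC : ∀ {A : Set} → (A → A → Set) → List A → List (List A) → Set
OrderedDLC E used []       = ⊤
OrderedDLC E used (C ∷ Cs) =
  IsLongestCycleIn (λ v → v ∉ used) E C × OrderedDLC E (used ++ C) Cs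

-- the sequence C⁽¹⁾, C⁽²⁾, … is continued as long as possible:
-- no cycle remains after removing all its vertices
Exhaustive : ∀ {A : Set} → (A → A → Set) → List (List A) → Set
Exhaustive E Cs = ∀ D → ¬ IsCycleIn (λ v → v ∉ concat Cs) E D

inList : ∀ {N} → Fin N → List (Fin N) → Bool
inList v xs = any (λ u → ⌊ u ≟ v ⌋) xs

complementOf : ∀ {N} → List (Fin N) → Subset N
complementOf xs = tabulate (λ v → not (inList v xs))

commonBlueIn : ∀ {N Δ} → EdgeColouring N → Subset N → (Fin Δ → Fin N) → ℕ
commonBlueIn {N} {Δ} χ W' f = ∣ tabulate (λ w → lookup W' w ∧ allBlue w) ∣
  where
    isBlue : Fin N → Fin N → Bool
    isBlue u w = not ⌊ u ≟ w ⌋ ∧ not (col χ u w)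
    allBlue : Fin N → Bool
    allBlue w = foldr _ _∧_ true (tabulate {n = Δ} (λ i → isBlue (f i) w))

ramseyN : (Δ n k σ : ℕ) → ℚ → ℕ
ramseyN Δ n k σ ε =
  (k ∸ 1) ℕ.* n ℕ.+ σ ℕ.+ ℤ.∣ ℚ.⌈ ℕ→ℚ (Δ ℕ.^ 4) ℚ.* ε ℚ.* ℕ→ℚ n ⌉ ∣

module Submission where

-- Let W be the set of vertices outside the first r ordered
-- disjoint longest red cycles.  Every red cycle inside W has fewer than ε² n
-- vertices: either no red cycle avoids C⁽¹⁾, …, C⁽ʳ⁾ at all, or C⁽ʳ⁺¹⁾ is a
-- longest one and is short by the maximality of r.  A graph whose cycles have
-- at most d + 1 vertices is d-degenerate (a subgraph of minimum degree d + 1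
-- contains a cycle with at least d + 2 vertices), so its degree sum is at most
-- 2 d |W|.  Deleting, one at a time, vertices of red degree at least
-- t = ⌊ε n⌋ lowers the degree sum by at least 2 t per deletion, so at most
-- d |W| / t ≤ ε |W| vertices are deleted, as d ≤ ε t.  In the remaining set W′
-- every vertex has fewer than t red neighbours in W′, so any Δ vertices of W′
-- exclude at most Δ t ≤ Δ ε n vertices of W′ from being common blue-neighbours.
-- The graph G only determines N and plays no further role; n₀ makes ε² n > 2.

open import Data.Nat using (ℕ)
open import Data.Fin using (Fin)
open import Data.Bool using (Bool; false)
open import Relation.Binary.PropositionalEquality using (_≡_)

module Counting where
  open import Data.Nat using (ℕ; zero; suc; _+_; _*_; _≤_; _<_; z≤n; s≤s)
  open import Data.Nat.Properties
    using (≤-refl; ≤-trans; ≤-reflexive; +-mono-≤; +-monoʳ-≤; ≤-pred; module ≤-Reasoning)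
  open import Data.Nat.Tactic.RingSolver using (solve-∀)
  open import Data.Fin using (Fin; zero; suc; _≟_)
  open import Data.Fin.Subset using (∣_∣; _∈_)
  open import Data.Bool using (Bool; true; false; not; _∧_; _∨_; if_then_else_)
  open import Data.Bool.Properties using (∧-zeroʳ; ∨-zeroʳ)
  open import Data.Vec using (tabulate; foldr)
  import Data.Vec.Properties as VecP
  open import Data.List using (List; []; _∷_; length)
  open import Data.List.Membership.Propositional using () renaming (_∈_ to _∈ₗ_)
  open import Data.List.Relation.Unary.Any using (here; there)
  open import Data.Empty using (⊥-elim)
  open import Relation.Nullary using (yes; no; ⌊_⌋)
  open import Relation.Binary.PropositionalEquality
  open import Defs using (inList)

  indicator : Bool → ℕ
  indicator true  = 1
  indicator false = 0

  sumFin : ∀ {N} → (Fin N → ℕ) → ℕ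
  sumFin {zero}  f = 0
  sumFin {suc N} f = f zero + sumFin (λ i → f (suc i))

  count : ∀ {N} → (Fin N → Bool) → ℕ
  count p = sumFin (λ i → indicator (p i))

  _without_ : ∀ {N} → (Fin N → Bool) → Fin N → Fin N → Bool
  (p without v) w = p w ∧ not ⌊ w ≟ v ⌋

  ≟-refl : ∀ {N} (i : Fin N) → ⌊ i ≟ i ⌋ ≡ true
  ≟-refl i with i ≟ i
  ... | yes _ = refl
  ... | no i≢i = ⊥-elim (i≢i refl)

  ≟-sym : ∀ {N} (u w : Fin N) → ⌊ u ≟ w ⌋ ≡ ⌊ w ≟ u ⌋
  ≟-sym u w with u ≟ w | w ≟ u
  ... | yes _    | yes _    = refl
  ... | no _     | no _     = refl
  ... | yes u≡w  | no w≢u   = ⊥-elim (w≢u (sym u≡w))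
  ... | no u≢w   | yes w≡u  = ⊥-elim (u≢w (sym w≡u))

  private
    suc≟suc : ∀ {N} (i v : Fin N) → ⌊ Fin.suc i ≟ Fin.suc v ⌋ ≡ ⌊ i ≟ v ⌋
    suc≟suc i v with i ≟ v
    ... | yes _ = refl
    ... | no _  = refl

  sumFin-cong : ∀ {N} {f g : Fin N → ℕ} → (∀ i → f i ≡ g i) → sumFin f ≡ sumFin g
  sumFin-cong {zero}  f≗g = refl
  sumFin-cong {suc N} f≗g = cong₂ _+_ (f≗g zero) (sumFin-cong (λ i → f≗g (suc i)))

  sumFin-mono : ∀ {N} {f g : Fin N → ℕ} → (∀ i → f i ≤ g i) → sumFin f ≤ sumFin g
  sumFin-mono {zero}  f≤g = z≤n
  sumFin-mono {suc N} f≤g = +-mono-≤ (f≤g zero) (sumFin-mono (λ i → f≤g (suc i)))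

  sumFin-+ : ∀ {N} (f g : Fin N → ℕ) → sumFin (λ i → f i + g i) ≡ sumFin f + sumFin g
  sumFin-+ {zero}  f g = refl
  sumFin-+ {suc N} f g =
    trans (cong (f zero + g zero +_) (sumFin-+ (λ i → f (suc i)) (λ i → g (suc i))))
          (interchange (f zero) (g zero) _ _)
    where
    interchange : ∀ a b c d → a + b + (c + d) ≡ (a + c) + (b + d)
    interchange = solve-∀

  sumFin-zero : ∀ {N} {f : Fin N → ℕ} → (∀ i → f i ≡ 0) → sumFin f ≡ 0
  sumFin-zero {zero}  f≗0 = refl
  sumFin-zero {suc N} f≗0 = cong₂ _+_ (f≗0 zero) (sumFin-zero (λ i → f≗0 (suc i)))

  sumFin-const : ∀ N t → sumFin {N} (λ _ → t) ≡ N * t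
  sumFin-const zero    t = refl
  sumFin-const (suc N) t = cong (t +_) (sumFin-const N t)

  sumFin-at : ∀ {N} (f : Fin N → ℕ) (v : Fin N) →
    sumFin f ≡ f v + sumFin (λ i → if ⌊ i ≟ v ⌋ then 0 else f i)
  sumFin-at {suc N} f zero    = refl
  sumFin-at {suc N} f (suc v) = begin
      f zero + sumFin (λ i → f (suc i))
    ≡⟨ cong (f zero +_) (sumFin-at (λ i → f (suc i)) v) ⟩
      f zero + (f (suc v) + rest)
    ≡⟨ swap (f zero) (f (suc v)) rest ⟩
      f (suc v) + (f zero + rest)
    ≡⟨ cong (λ s → f (suc v) + (f zero + s))
         (sumFin-cong (λ i → cong (λ b → if b then 0 else f (suc i)) (sym (suc≟suc i v)))) ⟩
      f (suc v) + (f zero + sumFin (λ i → if ⌊ Fin.suc i ≟ Fin.suc v ⌋ then 0 else f (suc i)))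
    ∎
    where
    open ≡-Reasoning
    rest : ℕ
    rest = sumFin (λ i → if ⌊ i ≟ v ⌋ then 0 else f (suc i))
    swap : ∀ a b c → a + (b + c) ≡ b + (a + c)
    swap = solve-∀

  count-cong : ∀ {N} {p q : Fin N → Bool} → (∀ i → p i ≡ q i) → count p ≡ count q
  count-cong p≗q = sumFin-cong (λ i → cong indicator (p≗q i))

  count-mono : ∀ {N} {p q : Fin N → Bool} → (∀ i → p i ≡ true → q i ≡ true) → count p ≤ count q
  count-mono {p = p} {q} p⇒q = sumFin-mono pointwise
    where
    pointwise : ∀ i → indicator (p i) ≤ indicator (q i)
    pointwise i with p i | p⇒q i
    ... | true  | qi = ≤-reflexive (cong indicator (sym (qi refl)))
    ... | false | _  = z≤n

  count-none : ∀ {N} {p : Fin N → Bool} → (∀ i → p i ≡ false) → count p ≡ 0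
  count-none none = sumFin-zero (λ i → cong indicator (none i))

  count-∨ : ∀ {N} (p q : Fin N → Bool) → count (λ i → p i ∨ q i) ≤ count p + count q
  count-∨ p q = ≤-trans (sumFin-mono pointwise)
                        (≤-reflexive (sumFin-+ (λ i → indicator (p i)) (λ i → indicator (q i))))
    where
    pointwise : ∀ i → indicator (p i ∨ q i) ≤ indicator (p i) + indicator (q i)
    pointwise i with p i | q i
    ... | true  | true  = s≤s z≤n
    ... | true  | false = ≤-refl
    ... | false | _     = ≤-refl

  count-split : ∀ {N} (p q : Fin N → Bool) →
    count p ≡ count (λ i → p i ∧ q i) + count (λ i → p i ∧ not (q i))
  count-split p q = trans (sumFin-cong pointwise)
    (sumFin-+ (λ i → indicator (p i ∧ q i)) (λ i → indicator (p i ∧ not (q i))))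
    where
    pointwise : ∀ i → indicator (p i) ≡ indicator (p i ∧ q i) + indicator (p i ∧ not (q i))
    pointwise i with p i | q i
    ... | true  | true  = refl
    ... | true  | false = refl
    ... | false | _     = refl

  count-at : ∀ {N} (p : Fin N → Bool) (v : Fin N) → count p ≡ indicator (p v) + count (p without v)
  count-at p v = trans (sumFin-at (λ i → indicator (p i)) v)
                       (cong (indicator (p v) +_) (sumFin-cong pointwise))
    where
    pointwise : ∀ i → (if ⌊ i ≟ v ⌋ then 0 else indicator (p i)) ≡ indicator ((p without v) i)
    pointwise i with ⌊ i ≟ v ⌋ | p i
    ... | true  | true  = refl
    ... | true  | false = refl
    ... | false | true  = refl
    ... | false | false = refl

  count-remove : ∀ {N} (p : Fin N → Bool) (v : Fin N) → p v ≡ true →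
    count p ≡ suc (count (p without v))
  count-remove p v pv = trans (count-at p v) (cong (λ b → indicator b + count (p without v)) pv)

  count-without-≤ : ∀ {N} (p : Fin N → Bool) v {k} → p v ≡ true → count p ≤ suc k → count (p without v) ≤ k
  count-without-≤ p v {k} pv size = ≤-pred (subst (_≤ suc k) (count-remove p v pv) size)

  count-pos : ∀ {N} (p : Fin N → Bool) (v : Fin N) → p v ≡ true → 0 < count p
  count-pos p v pv rewrite count-remove p v pv = s≤s z≤n

  count-singleton : ∀ {N} (u : Fin N) → count (λ w → ⌊ u ≟ w ⌋) ≡ 1
  count-singleton u = trans (count-remove _ u (≟-refl u)) (cong suc (count-none nowhere))
    where
    nowhere : ∀ w → (⌊ u ≟ w ⌋ ∧ not ⌊ w ≟ u ⌋) ≡ false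
    nowhere w with u ≟ w
    ... | no _ = refl
    ... | yes refl rewrite ≟-refl u = refl

  count-strict : ∀ {N} {p q : Fin N → Bool} (v : Fin N) → (∀ i → p i ≡ true → q i ≡ true) →
    q v ≡ true → p v ≡ false → count p < count q
  count-strict {p = p} {q} v p⇒q qv pv rewrite count-remove q v qv = s≤s (count-mono p⇒q∖v)
    where
    p⇒q∖v : ∀ i → p i ≡ true → (q without v) i ≡ true
    p⇒q∖v i pi with i ≟ v
    ... | yes refl with () ← trans (sym pv) pi
    ... | no _ rewrite p⇒q i pi = refl

  count-≤-length : ∀ {N} (p : Fin N → Bool) (xs : List (Fin N)) →
    (∀ i → p i ≡ true → i ∈ₗ xs) → count p ≤ length xs
  count-≤-length p [] covered = ≤-reflexive (count-none nowhere)
    where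
    nowhere : ∀ i → p i ≡ false
    nowhere i with p i in pi
    ... | true with () ← covered i pi
    ... | false = refl
  count-≤-length p (x ∷ xs) covered = begin
      count p
    ≡⟨ count-split p (λ w → ⌊ w ≟ x ⌋) ⟩
      count (λ w → p w ∧ ⌊ w ≟ x ⌋) + count (p without x)
    ≤⟨ +-mono-≤ (count-mono onlyX) (count-≤-length (p without x) xs coveredByXs) ⟩
      count (λ w → ⌊ x ≟ w ⌋) + length xs
    ≡⟨ cong (_+ length xs) (count-singleton x) ⟩
      suc (length xs)
    ∎
    where
    open ≤-Reasoning
    onlyX : ∀ i → (p i ∧ ⌊ i ≟ x ⌋) ≡ true → ⌊ x ≟ i ⌋ ≡ true
    onlyX i e with i ≟ x
    ... | yes refl = ≟-refl x
    ... | no _ with () ← trans (sym e) (∧-zeroʳ (p i))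
    coveredByXs : ∀ i → (p without x) i ≡ true → i ∈ₗ xs
    coveredByXs i e with p i in pi | i ≟ x
    ... | true | no i≢x with covered i pi
    ...   | here i≡x = ⊥-elim (i≢x i≡x)
    ...   | there i∈xs = i∈xs

  allOf : ∀ {N Δ} → (Fin Δ → Fin N → Bool) → Fin N → Bool
  allOf {Δ = Δ} g w = foldr (λ _ → Bool) _∧_ true (tabulate {n = Δ} (λ i → g i w))

  count-failing : ∀ {N} Δ (g : Fin Δ → Fin N → Bool) (p : Fin N → Bool) →
    count (λ w → p w ∧ not (allOf g w)) ≤ sumFin (λ i → count (λ w → p w ∧ not (g i w)))
  count-failing zero    g p = ≤-reflexive (count-none (λ w → ∧-zeroʳ (p w)))
  count-failing (suc Δ) g p = begin
      count (λ w → p w ∧ not (allOf g w))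
    ≤⟨ count-mono splitFailure ⟩
      count (λ w → failsFirst w ∨ failsRest w)
    ≤⟨ count-∨ failsFirst failsRest ⟩
      count failsFirst + count failsRest
    ≤⟨ +-monoʳ-≤ (count failsFirst) (count-failing Δ (λ i → g (suc i)) p) ⟩
      count failsFirst + sumFin (λ i → count (λ w → p w ∧ not (g (suc i) w)))
    ∎
    where
    open ≤-Reasoning
    failsFirst failsRest : Fin _ → Bool
    failsFirst w = p w ∧ not (g zero w)
    failsRest  w = p w ∧ not (allOf (λ i → g (suc i)) w)
    splitFailure : ∀ w → (p w ∧ not (allOf g w)) ≡ true → (failsFirst w ∨ failsRest w) ≡ true
    splitFailure w e with p w | g zero w | allOf (λ i → g (suc i)) w
    ... | true | false | _     = refl
    ... | true | true  | false = refl

  ∣tabulate∣ : ∀ {N} (p : Fin N → Bool) → ∣ tabulate p ∣ ≡ count p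
  ∣tabulate∣ {zero}  p = refl
  ∣tabulate∣ {suc N} p with p zero
  ... | true  = cong suc (∣tabulate∣ (λ i → p (suc i)))
  ... | false = ∣tabulate∣ (λ i → p (suc i))

  ∈-tabulate⁻ : ∀ {N} (p : Fin N → Bool) {x} → x ∈ tabulate p → p x ≡ true
  ∈-tabulate⁻ p {x} x∈ = trans (sym (VecP.lookup∘tabulate p x)) (VecP.[]=⇒lookup x∈)

  ∈-tabulate⁺ : ∀ {N} (p : Fin N → Bool) {x} → p x ≡ true → x ∈ tabulate p
  ∈-tabulate⁺ p {x} px = VecP.lookup⇒[]= x (tabulate p) (trans (VecP.lookup∘tabulate p x) px)

  inList→∈ : ∀ {N} (v : Fin N) xs → inList v xs ≡ true → v ∈ₗ xs
  inList→∈ v (x ∷ xs) e with x ≟ v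
  ... | yes refl = here refl
  ... | no _     = there (inList→∈ v xs e)

  ∈→inList : ∀ {N} {v : Fin N} {xs} → v ∈ₗ xs → inList v xs ≡ true
  ∈→inList {v = v} (here refl) rewrite ≟-refl v = refl
  ∈→inList {xs = x ∷ xs} (there v∈xs) rewrite ∈→inList v∈xs = ∨-zeroʳ _

module Cycles where
  open import Defs using (Path; IsCycleIn; OrderedDLC)
  open import Data.Nat using (zero; suc; _≤_)
  open import Data.List using ([]; _∷_; [_]; length; take; drop; concat; _++_)
  import Data.List.Properties as ListP
  open import Data.List.Membership.Propositional using () renaming (_∉_ to _∉ₗ_)
  import Data.List.Relation.Unary.All as All
  open import Data.Product using (_×_; _,_; proj₁)
  open import Data.Unit using (tt)
  open import Function using (_∘_)
  open import Relation.Binary.PropositionalEquality using (_≡_; refl; sym; subst)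

  Path-map : ∀ {A : Set} {E E′ : A → A → Set} → (∀ {x y} → E x y → E′ x y) →
    ∀ xs → Path E xs → Path E′ xs
  Path-map f []           _          = tt
  Path-map f (x ∷ [])     _          = tt
  Path-map f (x ∷ y ∷ xs) (xy , path) = f xy , Path-map f (y ∷ xs) path

  IsCycleIn-map : ∀ {A : Set} {P Q : A → Set} {E E′ : A → A → Set} →
    (∀ {v} → P v → Q v) → (∀ {x y} → E x y → E′ x y) → ∀ {D} → IsCycleIn P E D → IsCycleIn Q E′ D
  IsCycleIn-map f g {[]}    (long , uniq , inP , closed) = long , uniq , All.map f inP , tt
  IsCycleIn-map f g {x ∷ D} (long , uniq , inP , closed) =
    long , uniq , All.map f inP , Path-map g (x ∷ D ++ [ x ]) closed

  next-is-longest : ∀ {A : Set} (E : A → A → Set) used Cs r C rest →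
    OrderedDLC E used Cs → drop r Cs ≡ C ∷ rest →
    3 ≤ length C × (∀ D → IsCycleIn (λ v → v ∉ₗ used ++ concat (take r Cs)) E D → length D ≤ length C)
  next-is-longest E used (C ∷ Cs) zero .C .Cs ((isCycle , longest) , _) refl =
    proj₁ isCycle , λ D → longest D ∘ subst (λ L → IsCycleIn (λ v → v ∉ₗ L) E D) (ListP.++-identityʳ used)
  next-is-longest E used (C′ ∷ Cs) (suc r) C rest (_ , ordered) eq
    with next-is-longest E (used ++ C′) Cs r C rest ordered eq
  ... | long , longest = long , λ D → longest D ∘
          subst (λ L → IsCycleIn (λ v → v ∉ₗ L) E D) (sym (ListP.++-assoc used C′ (concat (take r Cs))))

module BooleanGraph {N : ℕ} (adj : Fin N → Fin N → Bool)
  (adj-sym : ∀ u v → adj u v ≡ adj v u) (adj-irrefl : ∀ v → adj v v ≡ false) where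
  open import Defs using (Path; IsCycleIn; inList)
  open import Data.Nat using (ℕ; zero; suc; _+_; _*_; _≤_; _<_; z≤n; s≤s; _≤?_)
  open import Data.Nat.Properties
    using ( ≤-refl; ≤-trans; ≤-reflexive; +-mono-≤; +-comm; +-suc; +-identityʳ; *-monoʳ-≤
          ; *-cancelˡ-≤; m≤m+n; ≤-pred; ≰⇒>; <⇒≱; module ≤-Reasoning)
  open import Data.Fin using (Fin; zero; suc; _≟_)
  open import Data.Fin.Properties using (any?)
  open import Data.Bool using (Bool; true; false; not; _∧_; if_then_else_)
  open import Data.Bool.Properties using (∧-zeroʳ; ∧-identityʳ; ∧-comm; ¬-not) renaming (_≟_ to _≟ᵇ_)
  open import Data.List using (List; []; _∷_; length; _++_; [_]; take)
  open import Data.List.Membership.Propositional using (_∈_)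
  open import Data.List.Relation.Unary.Any using (here; there)
  open import Data.List.Relation.Unary.All as All using (All; _∷_)
  import Data.List.Relation.Unary.All.Properties as AllP
  open import Data.List.Relation.Unary.Unique.Propositional using (Unique)
  open import Data.List.Relation.Unary.AllPairs using ([]; _∷_)
  import Data.List.Relation.Unary.Unique.Propositional.Properties as UniqueP
  open import Data.Product using (Σ; _×_; _,_; proj₂; ∃)
  open import Data.Sum using (_⊎_; inj₁; inj₂)
  open import Data.Unit using (tt)
  open import Data.Empty using (⊥-elim)
  open import Relation.Nullary using (¬_; yes; no; ⌊_⌋)
  open import Relation.Nullary.Decidable using (_×-dec_)
  open import Relation.Binary.PropositionalEquality
    using (_≡_; _≢_; refl; sym; trans; cong; cong₂; subst; module ≡-Reasoning)
  open import Data.Nat.Tactic.RingSolver using (solve-∀)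
  open import Function using (id)

  open Counting
  open Cycles using (IsCycleIn-map)

  VertexSet : Set
  VertexSet = Fin N → Bool

  _⊆ᵛ_ : VertexSet → VertexSet → Set
  S ⊆ᵛ T = ∀ v → S v ≡ true → T v ≡ true

  without-⊆ : ∀ S v → (S without v) ⊆ᵛ S
  without-⊆ S v w e with S w
  ... | true  = refl
  ... | false = e

  degree : VertexSet → Fin N → ℕ
  degree S v = count (λ w → S w ∧ adj v w)

  degreeSum : VertexSet → ℕ
  degreeSum S = sumFin (λ u → if S u then degree S u else 0)

  private
    ∧-swapʳ : ∀ x y z → ((x ∧ y) ∧ z) ≡ ((x ∧ z) ∧ y)
    ∧-swapʳ true  y z = ∧-comm y z
    ∧-swapʳ false y z = refl

    ∧-true-right : ∀ x {y} → (x ∧ y) ≡ true → y ≡ true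
    ∧-true-right true e = e

  degree-without : ∀ S v u → S v ≡ true →
    degree S u ≡ indicator (adj u v) + degree (S without v) u
  degree-without S v u Sv = trans (count-at (λ w → S w ∧ adj u w) v)
    (cong₂ _+_ (cong (λ b → indicator (b ∧ adj u v)) Sv)
               (count-cong (λ w → ∧-swapʳ (S w) (adj u w) _)))

  -- ... while the degree of v itself is unchanged, as v is not its own neighbour
  degree-without-self : ∀ S v → degree S v ≡ degree (S without v) v
  degree-without-self S v = trans (count-at (λ w → S w ∧ adj v w) v)
    (cong₂ _+_ (cong indicator (trans (cong (S v ∧_) (adj-irrefl v)) (∧-zeroʳ (S v))))
               (count-cong (λ w → ∧-swapʳ (S w) (adj v w) _)))

  degreeSum-without : ∀ S v → S v ≡ true →
    degreeSum S ≡ 2 * degree S v + degreeSum (S without v)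
  degreeSum-without S v Sv = begin
      degreeSum S
    ≡⟨ sumFin-at termS v ⟩
      termS v + sumFin (λ u → if ⌊ u ≟ v ⌋ then 0 else termS u)
    ≡⟨ cong₂ _+_ (cong (λ b → if b then degree S v else 0) Sv) (sumFin-cong pointwise) ⟩
      degree S v + sumFin (λ u → termS′ u + indicator (S′ u ∧ adj u v))
    ≡⟨ cong (degree S v +_) (sumFin-+ termS′ (λ u → indicator (S′ u ∧ adj u v))) ⟩
      degree S v + (degreeSum S′ + count (λ u → S′ u ∧ adj u v))
    ≡⟨ cong (λ k → degree S v + (degreeSum S′ + k)) neighboursOfV ⟩
      degree S v + (degreeSum S′ + degree S v)
    ≡⟨ regroup (degree S v) (degreeSum S′) ⟩
      2 * degree S v + degreeSum S′
    ∎
    where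
    open ≡-Reasoning
    S′ : VertexSet
    S′ = S without v
    termS termS′ : Fin N → ℕ
    termS  u = if S u then degree S u else 0
    termS′ u = if S′ u then degree S′ u else 0
    pointwise : ∀ u → (if ⌊ u ≟ v ⌋ then 0 else termS u) ≡ termS′ u + indicator (S′ u ∧ adj u v)
    pointwise u with u ≟ v
    ... | yes refl rewrite ∧-zeroʳ (S u) = refl
    ... | no _ with S u
    ...   | false = refl
    ...   | true  = trans (degree-without S v u Sv) (+-comm (indicator (adj u v)) _)
    neighboursOfV : count (λ u → S′ u ∧ adj u v) ≡ degree S v
    neighboursOfV = trans (count-cong (λ u → cong (S′ u ∧_) (adj-sym u v)))
                          (sym (degree-without-self S v))
    regroup : ∀ a e → a + (e + a) ≡ 2 * a + e
    regroup = solve-∀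

  degreeSum-empty : ∀ S → (∀ v → S v ≡ false) → degreeSum S ≡ 0
  degreeSum-empty S empty = sumFin-zero (λ u → cong (λ b → if b then degree S u else 0) (empty u))

  Adjacent : Fin N → Fin N → Set
  Adjacent u w = adj u w ≡ true

  CycleIn : VertexSet → List (Fin N) → Set
  CycleIn S = IsCycleIn (λ v → S v ≡ true) Adjacent

  LongCycleIn : VertexSet → ℕ → Set
  LongCycleIn S m = Σ (List (Fin N)) λ D → CycleIn S D × m ≤ length D

  SimplePathIn : VertexSet → List (Fin N) → Set
  SimplePathIn S P = Path Adjacent P × Unique P × All (λ v → S v ≡ true) P

  -- the longest prefix of a list ending in a neighbour of h
  toLastNeighbour : Fin N → List (Fin N) → List (Fin N)
  extendPrefix : Fin N → Fin N → List (Fin N) → List (Fin N)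
  toLastNeighbour h []       = []
  toLastNeighbour h (x ∷ xs) = extendPrefix h x (toLastNeighbour h xs)
  extendPrefix h x []         = if adj h x then [ x ] else []
  extendPrefix h x (y ∷ ys)   = x ∷ y ∷ ys

  toLastNeighbour-take : ∀ h xs → toLastNeighbour h xs ≡ take (length (toLastNeighbour h xs)) xs
  toLastNeighbour-take h [] = refl
  toLastNeighbour-take h (x ∷ xs) with toLastNeighbour h xs | toLastNeighbour-take h xs
  ... | y ∷ ys | eq = cong (x ∷_) eq
  ... | []     | _ with adj h x
  ...   | true  = refl
  ...   | false = refl

  toLastNeighbour-⊇ : ∀ h xs w → w ∈ xs → adj h w ≡ true → w ∈ toLastNeighbour h xs
  toLastNeighbour-⊇ h (x ∷ xs) w w∈ hw with toLastNeighbour h xs | toLastNeighbour-⊇ h xs w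
  toLastNeighbour-⊇ h (x ∷ xs) w (here refl) hw | []    | _ rewrite hw = here refl
  toLastNeighbour-⊇ h (x ∷ xs) w (there w∈) hw  | []    | ih with () ← ih w∈ hw
  toLastNeighbour-⊇ h (x ∷ xs) w (here refl) hw | _ ∷ _ | _  = here refl
  toLastNeighbour-⊇ h (x ∷ xs) w (there w∈) hw  | _ ∷ _ | ih = there (ih w∈ hw)

  toLastNeighbour-closes : ∀ h p xs → Path Adjacent (p ∷ xs) → 1 ≤ length (toLastNeighbour h xs) →
    Path Adjacent (p ∷ (toLastNeighbour h xs ++ [ h ]))
  toLastNeighbour-closes h p (x ∷ xs) (px , path) nonempty
    with toLastNeighbour h xs | toLastNeighbour-closes h x xs path
  ... | _ ∷ _ | ih = px , ih (s≤s z≤n)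
  ... | []    | _ with adj h x in hx
  ...   | true = px , trans (adj-sym x h) hx , tt
  toLastNeighbour-closes h p (x ∷ xs) (px , path) () | [] | _ | false

  -- if all S-neighbours of the head h of a simple path lie on the path, then
  -- closing the path at the farthest one gives a cycle longer than deg h
  closingCycle : ∀ S c h Q → 2 ≤ c → c ≤ degree S h → SimplePathIn S (h ∷ Q) →
    (∀ w → (S w ∧ adj h w) ≡ true → w ∈ Q) →
    LongCycleIn S (suc c)
  closingCycle S c h Q 2≤c c≤deg (path , uniq , inS) nbrsOnQ =
    h ∷ C , (s≤s (≤-trans 2≤c c≤|C|) , uniqC , inSC , toLastNeighbour-closes h h Q path 1≤|C|) , s≤s c≤|C|
    where
    C : List (Fin N)
    C = toLastNeighbour h Q
    C≡take : h ∷ C ≡ take (suc (length C)) (h ∷ Q)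
    C≡take = cong (h ∷_) (toLastNeighbour-take h Q)
    c≤|C| : c ≤ length C
    c≤|C| = ≤-trans c≤deg (count-≤-length _ C
      (λ w e → toLastNeighbour-⊇ h Q w (nbrsOnQ w e) (∧-true-right (S w) e)))
    1≤|C| : 1 ≤ length C
    1≤|C| = ≤-trans (s≤s z≤n) (≤-trans 2≤c c≤|C|)
    uniqC : Unique (h ∷ C)
    uniqC = subst Unique (sym C≡take) (UniqueP.take⁺ (suc (length C)) uniq)
    inSC : All (λ v → S v ≡ true) (h ∷ C)
    inSC = subst (All _) (sym C≡take) (AllP.take⁺ (suc (length C)) inS)

  unvisited : VertexSet → List (Fin N) → ℕ
  unvisited S P = count (λ w → S w ∧ not (inList w P))

  freshNeighbour : VertexSet → Fin N → List (Fin N) → Fin N → Bool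
  freshNeighbour S h P w = S w ∧ adj h w ∧ not (inList w P)

  decodeFresh : ∀ {a b c} → (a ∧ b ∧ not c) ≡ true → a ≡ true × b ≡ true × c ≡ false
  decodeFresh {true} {true} {false} refl = refl , refl , refl

  extendPath : ∀ S h Q w → SimplePathIn S (h ∷ Q) →
    S w ≡ true → adj h w ≡ true → inList w (h ∷ Q) ≡ false → SimplePathIn S (w ∷ h ∷ Q)
  extendPath S h Q w (path , uniq , inS) Sw hw off =
    (trans (adj-sym w h) hw , path) , All.tabulate w≢ ∷ uniq , Sw ∷ inS
    where
    w≢ : ∀ {y} → y ∈ h ∷ Q → w ≢ y
    w≢ y∈ refl with () ← trans (sym off) (∈→inList y∈)

  unvisited-extend : ∀ S P w → S w ≡ true → inList w P ≡ false → unvisited S (w ∷ P) < unvisited S P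
  unvisited-extend S P w Sw off = count-strict w shrinks wWasUnvisited wIsVisited
    where
    shrinks : ∀ i → (S i ∧ not (inList i (w ∷ P))) ≡ true → (S i ∧ not (inList i P)) ≡ true
    shrinks i e with S i | ⌊ w ≟ i ⌋ | inList i P
    ... | true | false | false = refl
    wWasUnvisited : (S w ∧ not (inList w P)) ≡ true
    wWasUnvisited rewrite Sw | off = refl
    wIsVisited : (S w ∧ not (inList w (w ∷ P))) ≡ false
    wIsVisited rewrite ≟-refl w = ∧-zeroʳ (S w)

  stuck⇒neighboursOnPath : ∀ S h Q → ¬ (∃ λ w → freshNeighbour S h (h ∷ Q) w ≡ true) →
    ∀ w → (S w ∧ adj h w) ≡ true → w ∈ Q
  stuck⇒neighboursOnPath S h Q stuck w e with inList w (h ∷ Q) in onPath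
  ... | false = ⊥-elim (stuck (w , subst (λ b → (S w ∧ adj h w ∧ not b) ≡ true) (sym onPath) noOff))
    where
    noOff : (S w ∧ adj h w ∧ not false) ≡ true
    noOff rewrite ∧-identityʳ (adj h w) = e
  ... | true with inList→∈ w (h ∷ Q) onPath
  ...   | there w∈Q = w∈Q
  ...   | here refl with () ← trans (sym (adj-irrefl h)) (∧-true-right (S h) e)

  longCycle : ∀ S c → 2 ≤ c → (∀ v → S v ≡ true → c ≤ degree S v) →
    ∀ v → S v ≡ true → LongCycleIn S (suc c)
  longCycle S c 2≤c minDeg v Sv = grow (suc (unvisited S [ v ])) v [] (tt , All.[] ∷ [] , Sv ∷ All.[]) ≤-refl
    where
    -- grow a path at its head as long as possible; the fuel bounds the unvisited vertices
    grow : ∀ fuel h Q → SimplePathIn S (h ∷ Q) → unvisited S (h ∷ Q) < fuel →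
      LongCycleIn S (suc c)
    grow (suc fuel) h Q path bound with any? (λ w → freshNeighbour S h (h ∷ Q) w ≟ᵇ true)
    ... | yes (w , fresh) =
      let Sw , hw , off = decodeFresh {S w} fresh in
      grow fuel w (h ∷ Q) (extendPath S h Q w path Sw hw off)
           (≤-trans (unvisited-extend S (h ∷ Q) w Sw off) (≤-pred bound))
    ... | no stuck = closingCycle S c h Q 2≤c (minDeg h (All.head (proj₂ (proj₂ path)))) path
                       (stuck⇒neighboursOnPath S h Q stuck)

  record Peeling (t : ℕ) (S : VertexSet) : Set where
    field
      core           : VertexSet
      core⊆          : core ⊆ᵛ S
      lowDegree      : ∀ v → core v ≡ true → degree core v < t
      removed        : ℕ
      count-removed  : count S ≡ count core + removed
      degreeSum-drop : 2 * (removed * t) + degreeSum core ≤ degreeSum S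

  peelAfter : ∀ {t} S v → S v ≡ true → t ≤ degree S v → Peeling t (S without v) → Peeling t S
  peelAfter {t} S v Sv t≤deg P = record
    { core           = core
    ; core⊆          = λ w e → without-⊆ S v w (core⊆ w e)
    ; lowDegree      = lowDegree
    ; removed        = suc removed
    ; count-removed  = trans (count-remove S v Sv) (trans (cong suc count-removed) (sym (+-suc _ removed)))
    ; degreeSum-drop = begin
          2 * (suc removed * t) + degreeSum core
        ≡⟨ regroup t removed (degreeSum core) ⟩
          2 * t + (2 * (removed * t) + degreeSum core)
        ≤⟨ +-mono-≤ (*-monoʳ-≤ 2 t≤deg) degreeSum-drop ⟩
          2 * degree S v + degreeSum (S without v)
        ≡⟨ sym (degreeSum-without S v Sv) ⟩
          degreeSum S
        ∎
    }
    where
    open Peeling P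
    open ≤-Reasoning
    regroup : ∀ t r e → 2 * (suc r * t) + e ≡ 2 * t + (2 * (r * t) + e)
    regroup = solve-∀

  peel : ∀ t S → Peeling t S
  peel t S = peelWithin (count S) S ≤-refl
    where
    peelWithin : ∀ fuel S → count S ≤ fuel → Peeling t S
    peelWithin fuel S size with any? (λ v → (S v ≟ᵇ true) ×-dec (t ≤? degree S v))
    ... | no none = record
      { core = S ; core⊆ = λ _ e → e
      ; lowDegree = λ v Sv → ≰⇒> (λ t≤deg → none (v , Sv , t≤deg))
      ; removed = 0 ; count-removed = sym (+-identityʳ (count S)) ; degreeSum-drop = ≤-refl }
    ... | yes (v , Sv , t≤deg) with fuel
    ...   | zero with () ← ≤-trans (count-pos S v Sv) size
    ...   | suc fuel′ =
      peelAfter S v Sv t≤deg (peelWithin fuel′ (S without v) (count-without-≤ S v Sv size))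

  -- Graphs all of whose cycles have at most d + 1 vertices are d-degenerate,
  -- hence have degree sum at most 2 d times their number of vertices.
  module ShortCycles (S₀ : VertexSet) (d : ℕ) (1≤d : 1 ≤ d)
    (short : ∀ D → CycleIn S₀ D → length D ≤ suc d) where

    LowDegreeVertex : VertexSet → Set
    LowDegreeVertex S = ∃ λ v → S v ≡ true × degree S v ≤ d

    minDegree : ∀ S → ¬ LowDegreeVertex S → ∀ w → S w ≡ true → suc d ≤ degree S w
    minDegree S none w Sw = ≰⇒> (λ deg≤d → none (w , Sw , deg≤d))

    -- minimum degree d + 1 would force a cycle with at least d + 2 vertices
    lowDegreeVertex : ∀ S → S ⊆ᵛ S₀ → LowDegreeVertex S ⊎ (∀ v → S v ≡ false)
    lowDegreeVertex S S⊆S₀ with any? (λ v → (S v ≟ᵇ true) ×-dec (degree S v ≤? d))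
    ... | yes found = inj₁ found
    ... | no none with any? (λ v → S v ≟ᵇ true)
    ...   | no empty = inj₂ (λ v → ¬-not (λ Sv → empty (v , Sv)))
    ...   | yes (v , Sv) with longCycle S (suc d) (s≤s 1≤d) (minDegree S none) v Sv
    ...     | D , isCycle , longer = ⊥-elim (<⇒≱ longer (short D (IsCycleIn-map (S⊆S₀ _) id isCycle)))

    degreeSum-bound : ∀ S → S ⊆ᵛ S₀ → degreeSum S ≤ 2 * (count S * d)
    degreeSum-bound S = bound (count S) S ≤-refl
      where
      bound : ∀ fuel S → count S ≤ fuel → S ⊆ᵛ S₀ → degreeSum S ≤ 2 * (count S * d)
      bound fuel S size S⊆S₀ with lowDegreeVertex S S⊆S₀
      ... | inj₂ empty = ≤-trans (≤-reflexive (degreeSum-empty S empty)) z≤n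
      ... | inj₁ (v , Sv , deg≤d) with fuel
      ...   | zero with () ← ≤-trans (count-pos S v Sv) size
      ...   | suc fuel′ = begin
          degreeSum S
        ≡⟨ degreeSum-without S v Sv ⟩
          2 * degree S v + degreeSum S′
        ≤⟨ +-mono-≤ (*-monoʳ-≤ 2 deg≤d)
                    (bound fuel′ S′ (count-without-≤ S v Sv size) (λ w e → S⊆S₀ w (without-⊆ S v w e))) ⟩
          2 * d + 2 * (count S′ * d)
        ≡⟨ regroup d (count S′) ⟩
          2 * (suc (count S′) * d)
        ≡⟨ cong (λ m → 2 * (m * d)) (sym (count-remove S v Sv)) ⟩
          2 * (count S * d)
        ∎
        where
        open ≤-Reasoning
        S′ : VertexSet
        S′ = S without v
        regroup : ∀ d m → 2 * d + 2 * (m * d) ≡ 2 * (suc m * d)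
        regroup = solve-∀

    peeling-removes-few : ∀ {t} (P : Peeling t S₀) → Peeling.removed P * t ≤ count S₀ * d
    peeling-removes-few P = *-cancelˡ-≤ 2 (begin
        2 * (removed * _)
      ≤⟨ m≤m+n _ _ ⟩
        2 * (removed * _) + degreeSum core
      ≤⟨ degreeSum-drop ⟩
        degreeSum S₀
      ≤⟨ degreeSum-bound S₀ (λ _ e → e) ⟩
        2 * (count S₀ * d)
      ∎)
      where
      open Peeling P
      open ≤-Reasoning

module Rational where
  open import Defs using (ℕ→ℚ)
  open import Data.Nat as ℕ using (ℕ; zero; suc)
  import Data.Nat.Properties as ℕP
  open import Data.Integer as ℤ using (+_)
  import Data.Integer.Properties as ℤP
  open import Data.Rational as ℚ
    using (ℚ; 0ℚ; 1ℚ; mkℚ; toℚᵘ; _≤_; _<_; _+_; _*_; _-_; -_; Positive; NonNegative)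
  import Data.Rational.Properties as ℚP
  open import Data.Rational.Unnormalised as ℚᵘ using (mkℚᵘ; *≡*; *≤*)
  import Data.Rational.Unnormalised.Properties as ℚᵘP
  import Data.Nat.Coprimality as Coprime
  open import Data.Rational.Solver using (module +-*-Solver)
  open +-*-Solver using (solve; _:+_; _:*_; _:-_; con; _:=_)
  open import Data.Integer.Tactic.RingSolver using () renaming (solve-∀ to ℤ-solve-∀)
  open import Data.Product using (Σ; _×_; _,_)
  open import Data.Empty using (⊥-elim)
  open import Relation.Nullary using (yes; no)
  open import Relation.Nullary.Decidable using (from-yes)
  open import Relation.Binary.PropositionalEquality
    using (_≡_; refl; sym; trans; cong; subst; subst₂)


  private
    ℕ→ℚ-mkℚ : ∀ a → ℕ→ℚ a ≡ mkℚ (+ a) 0 (Coprime.sym (Coprime.1-coprimeTo a))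
    ℕ→ℚ-mkℚ a = ℚP.normalize-coprime (Coprime.sym (Coprime.1-coprimeTo a))

    ℕ→ℚ-toℚᵘ : ∀ a → toℚᵘ (ℕ→ℚ a) ≡ mkℚᵘ (+ a) 0
    ℕ→ℚ-toℚᵘ a = cong toℚᵘ (ℕ→ℚ-mkℚ a)

  ℕ→ℚ-+ : ∀ a b → ℕ→ℚ (a ℕ.+ b) ≡ ℕ→ℚ a + ℕ→ℚ b
  ℕ→ℚ-+ a b = ℚP.toℚᵘ-injective (ℚᵘP.≃-trans
    (subst₂ (λ x y → toℚᵘ (ℕ→ℚ (a ℕ.+ b)) ℚᵘ.≃ (x ℚᵘ.+ y)) (sym (ℕ→ℚ-toℚᵘ a)) (sym (ℕ→ℚ-toℚᵘ b))
      (subst (ℚᵘ._≃ (mkℚᵘ (+ a) 0 ℚᵘ.+ mkℚᵘ (+ b) 0)) (sym (ℕ→ℚ-toℚᵘ (a ℕ.+ b)))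
        (*≡* (trans (cong (ℤ._* + 1) (ℤP.pos-+ a b)) (cross (+ a) (+ b))))))
    (ℚᵘP.≃-sym (ℚP.toℚᵘ-homo-+ (ℕ→ℚ a) (ℕ→ℚ b))))
    where
    cross : ∀ x y → (x ℤ.+ y) ℤ.* + 1 ≡ (x ℤ.* + 1 ℤ.+ y ℤ.* + 1) ℤ.* + 1
    cross = ℤ-solve-∀

  ℕ→ℚ-* : ∀ a b → ℕ→ℚ (a ℕ.* b) ≡ ℕ→ℚ a * ℕ→ℚ b
  ℕ→ℚ-* a b = ℚP.toℚᵘ-injective (ℚᵘP.≃-trans
    (subst₂ (λ x y → toℚᵘ (ℕ→ℚ (a ℕ.* b)) ℚᵘ.≃ (x ℚᵘ.* y)) (sym (ℕ→ℚ-toℚᵘ a)) (sym (ℕ→ℚ-toℚᵘ b))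
      (subst (ℚᵘ._≃ (mkℚᵘ (+ a) 0 ℚᵘ.* mkℚᵘ (+ b) 0)) (sym (ℕ→ℚ-toℚᵘ (a ℕ.* b)))
        (*≡* (cong (ℤ._* + 1) (ℤP.pos-* a b)))))
    (ℚᵘP.≃-sym (ℚP.toℚᵘ-homo-* (ℕ→ℚ a) (ℕ→ℚ b))))

  ℕ→ℚ-suc : ∀ t → ℕ→ℚ (suc t) ≡ ℕ→ℚ t + 1ℚ
  ℕ→ℚ-suc t = trans (cong ℕ→ℚ (ℕP.+-comm 1 t)) (ℕ→ℚ-+ t 1)

  ℕ→ℚ-mono-≤ : ∀ {a b} → a ℕ.≤ b → ℕ→ℚ a ≤ ℕ→ℚ b
  ℕ→ℚ-mono-≤ {a} {b} a≤b rewrite ℕ→ℚ-mkℚ a | ℕ→ℚ-mkℚ b =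
    ℚ.*≤* (subst₂ ℤ._≤_ (sym (ℤP.*-identityʳ (+ a))) (sym (ℤP.*-identityʳ (+ b))) (ℤ.+≤+ a≤b))

  ℕ→ℚ-cancel-≤ : ∀ {a b} → ℕ→ℚ a ≤ ℕ→ℚ b → a ℕ.≤ b
  ℕ→ℚ-cancel-≤ {a} {b} a≤b rewrite ℕ→ℚ-mkℚ a | ℕ→ℚ-mkℚ b with ℚP.drop-*≤* a≤b
  ... | a*1≤b*1 rewrite ℤP.*-identityʳ (+ a) | ℤP.*-identityʳ (+ b) = ℤP.drop‿+≤+ a*1≤b*1

  ℕ→ℚ-nonNeg : ∀ a → NonNegative (ℕ→ℚ a)
  ℕ→ℚ-nonNeg a = ℚ.nonNegative (ℕ→ℚ-mono-≤ {0} {a} ℕ.z≤n)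

  archimedean : ∀ ε → 0ℚ < ε → Σ ℕ λ q → 1ℚ ≤ ε * ℕ→ℚ q
  archimedean (mkℚ (+ suc p) q-1 _) _ = suc q-1 , ℚP.toℚᵘ-cancel-≤
    (ℚᵘP.≤-respʳ-≃ (ℚᵘP.≃-sym (ℚP.toℚᵘ-homo-* (mkℚ (+ suc p) q-1 _) (ℕ→ℚ (suc q-1))))
      (subst (λ z → mkℚᵘ (+ 1) 0 ℚᵘ.≤ (mkℚᵘ (+ suc p) q-1 ℚᵘ.* z)) (sym (ℕ→ℚ-toℚᵘ (suc q-1)))
        (*≤* cross)))
    where
    cross : (+ 1) ℤ.* (+ suc (q-1 ℕ.* 1)) ℤ.≤ ((+ suc p) ℤ.* (+ suc q-1)) ℤ.* (+ 1)
    cross rewrite ℤP.*-identityˡ (+ suc (q-1 ℕ.* 1)) | ℤP.*-identityʳ ((+ suc p) ℤ.* (+ suc q-1))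
                | sym (ℤP.pos-* (suc p) (suc q-1)) | ℕP.*-identityʳ q-1 =
      ℤ.+≤+ (ℕP.m≤n*m (suc q-1) (suc p))
  archimedean (mkℚ (+ zero) _ _)   (ℚ.*<* (ℤ.+<+ ()))
  archimedean (mkℚ ℤ.-[1+ _ ] _ _) (ℚ.*<* ())

  module _ {ε : ℚ} (ε>0 : 0ℚ < ε) where
    open ℚP.≤-Reasoning

    private instance
      ε-pos : Positive ε
      ε-pos = ℚ.positive ε>0
      ε-nonNeg : NonNegative ε
      ε-nonNeg = ℚP.pos⇒nonNeg ε

    ≤1-if-multiple≤1 : ∀ D → ε * ℕ→ℚ D ≤ 1ℚ → 1 ℕ.≤ D → ε ≤ 1ℚ
    ≤1-if-multiple≤1 D εD≤1 1≤D = begin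
        ε             ≡⟨ sym (ℚP.*-identityʳ ε) ⟩
        ε * 1ℚ        ≤⟨ ℚP.*-monoˡ-≤-nonNeg ε (ℕ→ℚ-mono-≤ 1≤D) ⟩
        ε * ℕ→ℚ D    ≤⟨ εD≤1 ⟩
        1ℚ            ∎

    eventually-ε²n>2 : Σ ℕ λ n₀ → ∀ n → n₀ ℕ.≤ n → ℕ→ℚ 2 < ε * ε * ℕ→ℚ n
    eventually-ε²n>2 with archimedean ε ε>0
    ... | q , 1≤εq = 3 ℕ.* (q ℕ.* q) , λ n n₀≤n → begin-strict
        ℕ→ℚ 2
      <⟨ from-yes (ℕ→ℚ 2 ℚP.<? ℕ→ℚ 3) ⟩
        ℕ→ℚ 3 * (1ℚ * 1ℚ)
      ≤⟨ ℚP.*-monoˡ-≤-nonNeg (ℕ→ℚ 3) (ℚP.≤-trans (ℚP.*-monoʳ-≤-nonNeg 1ℚ 1≤εq) (ℚP.*-monoˡ-≤-nonNeg εq 1≤εq)) ⟩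
        ℕ→ℚ 3 * (εq * εq)
      ≡⟨ solve 3 (λ t e x → t :* ((e :* x) :* (e :* x)) := e :* e :* (t :* (x :* x))) refl (ℕ→ℚ 3) ε (ℕ→ℚ q) ⟩
        ε * ε * (ℕ→ℚ 3 * (ℕ→ℚ q * ℕ→ℚ q))
      ≡⟨ cong (ε * ε *_) (sym (trans (ℕ→ℚ-* 3 (q ℕ.* q)) (cong (ℕ→ℚ 3 *_) (ℕ→ℚ-* q q)))) ⟩
        ε * ε * ℕ→ℚ (3 ℕ.* (q ℕ.* q))
      ≤⟨ ℚP.*-monoˡ-≤-nonNeg (ε * ε) (ℕ→ℚ-mono-≤ n₀≤n) ⟩
        ε * ε * ℕ→ℚ n
      ∎
      where
      εq : ℚ
      εq = ε * ℕ→ℚ q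
      instance
        _ : NonNegative (ε * ε)
        _ = ℚP.nonNeg*nonNeg⇒nonNeg ε ε
        _ : NonNegative (ℕ→ℚ 3)
        _ = ℕ→ℚ-nonNeg 3
        _ : NonNegative εq
        _ = ℚ.nonNegative (ℚP.≤-trans (ℚP.<⇒≤ (ℚP.positive⁻¹ 1ℚ)) 1≤εq)

    positive-if-above : ∀ d t → 1 ℕ.≤ d → ℕ→ℚ d ≤ ε * ℕ→ℚ t → 1 ℕ.≤ t
    positive-if-above d (suc t) _   _   = ℕ.s≤s ℕ.z≤n
    positive-if-above d zero    1≤d d≤0 =
      ⊥-elim (ℕP.<⇒≱ 1≤d (ℕ→ℚ-cancel-≤ {d} {0} (ℚP.≤-trans d≤0 (ℚP.≤-reflexive (ℚP.*-zeroʳ ε)))))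

    module _ (ε≤1 : ε ≤ 1ℚ) where

      εn-range : ∀ n → 0ℚ ≤ ε * ℕ→ℚ n × ε * ℕ→ℚ n < ℕ→ℚ (suc n)
      εn-range n = ℚP.nonNegative⁻¹ (ε * ℕ→ℚ n) {{ℚP.nonNeg*nonNeg⇒nonNeg ε (ℕ→ℚ n) {{ℕ→ℚ-nonNeg n}}}} ,
        (begin-strict
          ε * ℕ→ℚ n
        ≤⟨ ℚP.*-monoʳ-≤-nonNeg (ℕ→ℚ n) {{ℕ→ℚ-nonNeg n}} ε≤1 ⟩
          1ℚ * ℕ→ℚ n
        ≡⟨ solve 1 (λ x → con 1ℚ :* x := x :+ con 0ℚ) refl (ℕ→ℚ n) ⟩
          ℕ→ℚ n + 0ℚ
        <⟨ ℚP.+-monoʳ-< (ℕ→ℚ n) (ℚP.positive⁻¹ 1ℚ) ⟩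
          ℕ→ℚ n + 1ℚ
        ≡⟨ sym (ℕ→ℚ-suc n) ⟩
          ℕ→ℚ (suc n)
        ∎)

      ≤ε-multiple : ∀ n t d → ε * ℕ→ℚ n < ℕ→ℚ (suc t) → ℕ→ℚ (suc d) < ε * ε * ℕ→ℚ n →
        ℕ→ℚ d ≤ ε * ℕ→ℚ t
      ≤ε-multiple n t d εn<t+1 d+1<ε²n = ℚP.<⇒≤ (begin-strict
          ℕ→ℚ d
        ≡⟨ solve 1 (λ x → x := (x :+ con 1ℚ) :- con 1ℚ) refl (ℕ→ℚ d) ⟩
          (ℕ→ℚ d + 1ℚ) - 1ℚ
        ≡⟨ cong (_- 1ℚ) (sym (ℕ→ℚ-suc d)) ⟩
          ℕ→ℚ (suc d) - 1ℚ
        <⟨ ℚP.+-monoˡ-< (- 1ℚ) d+1<ε²n ⟩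
          ε * ε * ℕ→ℚ n - 1ℚ
        ≡⟨ cong (_- 1ℚ) (ℚP.*-assoc ε ε (ℕ→ℚ n)) ⟩
          ε * (ε * ℕ→ℚ n) - 1ℚ
        <⟨ ℚP.+-monoˡ-< (- 1ℚ) (ℚP.*-monoʳ-<-pos ε εn<t+1) ⟩
          ε * ℕ→ℚ (suc t) - 1ℚ
        ≡⟨ cong (λ z → ε * z - 1ℚ) (ℕ→ℚ-suc t) ⟩
          ε * (ℕ→ℚ t + 1ℚ) - 1ℚ
        ≡⟨ solve 2 (λ e x → e :* (x :+ con 1ℚ) :- con 1ℚ := e :* x :+ (e :- con 1ℚ)) refl ε (ℕ→ℚ t) ⟩
          ε * ℕ→ℚ t + (ε - 1ℚ)
        ≤⟨ ℚP.+-monoʳ-≤ (ε * ℕ→ℚ t) (ℚP.+-monoˡ-≤ (- 1ℚ) ε≤1) ⟩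
          ε * ℕ→ℚ t + (1ℚ - 1ℚ)
        ≡⟨ solve 1 (λ x → x :+ (con 1ℚ :- con 1ℚ) := x) refl (ε * ℕ→ℚ t) ⟩
          ε * ℕ→ℚ t
        ∎)

    kept-fraction : ∀ X t m d w → X ℕ.* t ℕ.≤ m ℕ.* d → 1 ℕ.≤ t → ℕ→ℚ d ≤ ε * ℕ→ℚ t →
      m ≡ w ℕ.+ X → (1ℚ - ε) * ℕ→ℚ m ≤ ℕ→ℚ w
    kept-fraction X t m d w Xt≤md 1≤t d≤εt refl = begin
        (1ℚ - ε) * ℕ→ℚ (w ℕ.+ X)
      ≡⟨ cong ((1ℚ - ε) *_) (ℕ→ℚ-+ w X) ⟩
        (1ℚ - ε) * (ℕ→ℚ w + ℕ→ℚ X)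
      ≡⟨ solve 3 (λ e a b → (con 1ℚ :- e) :* (a :+ b) := a :+ (b :- (a :+ b) :* e)) refl ε (ℕ→ℚ w) (ℕ→ℚ X) ⟩
        ℕ→ℚ w + (ℕ→ℚ X - εm)
      ≤⟨ ℚP.+-monoʳ-≤ (ℕ→ℚ w) (ℚP.+-monoˡ-≤ (- εm) X≤εm) ⟩
        ℕ→ℚ w + (εm - εm)
      ≡⟨ solve 2 (λ a y → a :+ (y :- y) := a) refl (ℕ→ℚ w) εm ⟩
        ℕ→ℚ w
      ∎
      where
      εm : ℚ
      εm = (ℕ→ℚ w + ℕ→ℚ X) * ε
      instance
        _ : NonNegative (ℕ→ℚ (w ℕ.+ X))
        _ = ℕ→ℚ-nonNeg (w ℕ.+ X)
        _ : Positive (ℕ→ℚ t)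
        _ = ℚ.positive (ℚP.<-≤-trans (ℚP.positive⁻¹ 1ℚ) (ℕ→ℚ-mono-≤ 1≤t))
      X≤εm : ℕ→ℚ X ≤ εm
      X≤εm = ℚP.*-cancelʳ-≤-pos (ℕ→ℚ t) (begin
          ℕ→ℚ X * ℕ→ℚ t
        ≡⟨ sym (ℕ→ℚ-* X t) ⟩
          ℕ→ℚ (X ℕ.* t)
        ≤⟨ ℕ→ℚ-mono-≤ Xt≤md ⟩
          ℕ→ℚ ((w ℕ.+ X) ℕ.* d)
        ≡⟨ ℕ→ℚ-* (w ℕ.+ X) d ⟩
          ℕ→ℚ (w ℕ.+ X) * ℕ→ℚ d
        ≤⟨ ℚP.*-monoˡ-≤-nonNeg (ℕ→ℚ (w ℕ.+ X)) d≤εt ⟩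
          ℕ→ℚ (w ℕ.+ X) * (ε * ℕ→ℚ t)
        ≡⟨ cong (_* (ε * ℕ→ℚ t)) (ℕ→ℚ-+ w X) ⟩
          (ℕ→ℚ w + ℕ→ℚ X) * (ε * ℕ→ℚ t)
        ≡⟨ sym (ℚP.*-assoc (ℕ→ℚ w + ℕ→ℚ X) ε (ℕ→ℚ t)) ⟩
          εm * ℕ→ℚ t
        ∎)

    subtract-Δεn : ∀ n t w c Δ → w ℕ.≤ c ℕ.+ Δ ℕ.* t → ℕ→ℚ t ≤ ε * ℕ→ℚ n →
      ℕ→ℚ w - ℕ→ℚ Δ * ε * ℕ→ℚ n ≤ ℕ→ℚ c
    subtract-Δεn n t w c Δ w≤c+Δt t≤εn = begin
        ℕ→ℚ w - Δεn
      ≤⟨ ℚP.+-monoˡ-≤ (- Δεn) (ℕ→ℚ-mono-≤ w≤c+Δt) ⟩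
        ℕ→ℚ (c ℕ.+ Δ ℕ.* t) - Δεn
      ≡⟨ cong (_- Δεn) (trans (ℕ→ℚ-+ c (Δ ℕ.* t)) (cong (λ z → ℕ→ℚ c + z) (ℕ→ℚ-* Δ t))) ⟩
        (ℕ→ℚ c + ℕ→ℚ Δ * ℕ→ℚ t) - Δεn
      ≤⟨ ℚP.+-monoˡ-≤ (- Δεn) (ℚP.+-monoʳ-≤ (ℕ→ℚ c) (ℚP.*-monoˡ-≤-nonNeg (ℕ→ℚ Δ) {{ℕ→ℚ-nonNeg Δ}} t≤εn)) ⟩
        (ℕ→ℚ c + ℕ→ℚ Δ * (ε * ℕ→ℚ n)) - Δεn
      ≡⟨ solve 4 (λ c D e m → (c :+ D :* (e :* m)) :- D :* e :* m := c) refl (ℕ→ℚ c) (ℕ→ℚ Δ) ε (ℕ→ℚ n) ⟩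
        ℕ→ℚ c
      ∎
      where
      Δεn : ℚ
      Δεn = ℕ→ℚ Δ * ε * ℕ→ℚ n

  IntegerPart : ℚ → Set
  IntegerPart x = Σ ℕ λ t → ℕ→ℚ t ≤ x × x < ℕ→ℚ (suc t)

  integerPart : ∀ (x : ℚ) n → 0ℚ ≤ x × x < ℕ→ℚ (suc n) → IntegerPart x
  integerPart x zero    (0≤x , x<1)   = 0 , 0≤x , x<1
  integerPart x (suc n) (0≤x , x<n+2) with ℕ→ℚ (suc n) ℚP.≤? x
  ... | yes n+1≤x = suc n , n+1≤x , x<n+2
  ... | no  n+1≰x = integerPart x n (0≤x , ℚP.≰⇒> n+1≰x)


open import Defs hiding (sym; degree)
open import Data.Nat as ℕ using (ℕ; suc; _+_; _*_; _≤_; _<_; z≤n; s≤s; _^_)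
import Data.Nat.Properties as ℕP
open import Data.Rational as ℚ using (ℚ; 0ℚ; 1ℚ)
import Data.Rational.Properties as ℚP
open import Data.Fin using (Fin; _≟_)
open import Data.Fin.Subset using (Subset; ∣_∣; _⊆_; _∈_)
open import Data.Bool using (Bool; true; false; not; _∧_; _∨_)
open import Data.Vec using (tabulate; lookup)
import Data.Vec.Properties as VecP
open import Data.List using (List; []; _∷_; length; take; drop; concat; _++_)
import Data.List.Properties as ListP
open import Data.List.Membership.Propositional using () renaming (_∈_ to _∈ₗ_; _∉_ to _∉ₗ_)
open import Data.List.Relation.Unary.All using (All)
open import Data.Product using (Σ; _×_; _,_; proj₁; proj₂)
open import Data.Empty using (⊥-elim)
open import Relation.Nullary using (¬_; no; ⌊_⌋)
open import Relation.Binary.PropositionalEquality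
  using (_≡_; refl; sym; trans; cong; cong₂; subst; subst₂)
open import Function.Definitions using (Injective)

open Counting
open Cycles

module RedBlue {N : ℕ} (χ : EdgeColouring N) where

  red : Fin N → Fin N → Bool
  red u w = not ⌊ u ≟ w ⌋ ∧ col χ u w

  red-sym : ∀ u w → red u w ≡ red w u
  red-sym u w = cong₂ (λ x y → not x ∧ y) (≟-sym u w) (colSym χ u w)

  red-irrefl : ∀ v → red v v ≡ false
  red-irrefl v rewrite ≟-refl v = refl

  red⇒Red : ∀ {u w} → red u w ≡ true → Red χ u w
  red⇒Red {u} {w} e with u ≟ w
  ... | no u≢w = u≢w , e

  outside : List (Fin N) → Fin N → Bool
  outside L w = not (inList w L)

  outside⇒∉ : ∀ {L v} → outside L v ≡ true → v ∉ₗ L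
  outside⇒∉ {v = v} out v∈L with () ← trans (sym out) (cong not (∈→inList v∈L))

  open BooleanGraph red red-sym red-irrefl public

  toRedCycle : ∀ {L D} → CycleIn (outside L) D → IsCycleIn (λ v → v ∉ₗ L) (Red χ) D
  toRedCycle = IsCycleIn-map outside⇒∉ red⇒Red

  CycleBound : (Fin N → Bool) → ℚ → Set
  CycleBound W b = Σ ℕ λ d → 1 ≤ d × (∀ D → CycleIn W D → length D ≤ suc d) × ℕ→ℚ (suc d) ℚ.< b

  remainingCyclesShort : ∀ (b : ℚ) Cs r → OrderedDLC (Red χ) [] Cs → Exhaustive (Red χ) Cs →
    (∀ C rest → drop r Cs ≡ C ∷ rest → ¬ (b ℚ.≤ ℕ→ℚ (length C))) → ℕ→ℚ 2 ℚ.< b →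
    CycleBound (outside (concat (take r Cs))) b
  remainingCyclesShort b Cs r ordered exhaustive nextShort 2<b with drop r Cs in rest≡
  ... | [] = 1 , s≤s z≤n , noCycle , 2<b
    where
    allTaken : take r Cs ≡ Cs
    allTaken = trans (sym (ListP.++-identityʳ (take r Cs)))
                     (trans (cong (take r Cs ++_) (sym rest≡)) (ListP.take++drop≡id r Cs))
    noCycle : ∀ D → CycleIn (outside (concat (take r Cs))) D → length D ≤ 2
    noCycle D isCycle = ⊥-elim (exhaustive D
      (subst (λ X → IsCycleIn (λ v → v ∉ₗ concat X) (Red χ) D) allTaken (toRedCycle isCycle)))
  ... | C ∷ rest with next-is-longest (Red χ) [] Cs r C rest ordered rest≡
  ...   | 3≤|C| , longest =
    ℕ.pred (length C) , ℕP.≤-trans (s≤s z≤n) (ℕP.pred-mono-≤ 3≤|C|) ,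
    (λ D isCycle → ℕP.≤-trans (longest D (toRedCycle isCycle)) (ℕP.≤-reflexive (sym sucPred))) ,
    subst (λ m → ℕ→ℚ m ℚ.< b) (sym sucPred) (ℚP.≰⇒> (nextShort C rest refl))
    where
    sucPred : suc (ℕ.pred (length C)) ≡ length C
    sucPred = ℕP.suc-pred (length C) {{ℕ.>-nonZero (ℕP.≤-trans (s≤s z≤n) 3≤|C|)}}

  blue : Fin N → Fin N → Bool
  blue u w = not ⌊ u ≟ w ⌋ ∧ not (col χ u w)

  -- the vertices of W that are not blue-neighbours of u are u itself and
  -- the red neighbours of u in W
  nonBlue-≤ : ∀ W u → count (λ w → W w ∧ not (blue u w)) ≤ 1 + degree W u
  nonBlue-≤ W u = begin
      count (λ w → W w ∧ not (blue u w))
    ≤⟨ count-mono selfOrRed ⟩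
      count (λ w → ⌊ u ≟ w ⌋ ∨ (W w ∧ red u w))
    ≤⟨ count-∨ (λ w → ⌊ u ≟ w ⌋) (λ w → W w ∧ red u w) ⟩
      count (λ w → ⌊ u ≟ w ⌋) + degree W u
    ≡⟨ cong (_+ degree W u) (count-singleton u) ⟩
      1 + degree W u
    ∎
    where
    open ℕP.≤-Reasoning
    selfOrRed : ∀ w → (W w ∧ not (blue u w)) ≡ true → (⌊ u ≟ w ⌋ ∨ (W w ∧ red u w)) ≡ true
    selfOrRed w e with W w | ⌊ u ≟ w ⌋ | col χ u w
    ... | true | true  | _    = refl
    ... | true | false | true = refl

  commonBlueIn-count : ∀ {Δ} W (f : Fin Δ → Fin N) →
    commonBlueIn χ (tabulate W) f ≡ count (λ w → W w ∧ allOf (λ i → blue (f i)) w)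
  commonBlueIn-count W f = trans (∣tabulate∣ (λ w → lookup (tabulate W) w ∧ allOf (λ i → blue (f i)) w))
    (count-cong (λ w → cong (_∧ allOf (λ i → blue (f i)) w) (VecP.lookup∘tabulate W w)))

  commonBlue-bound : ∀ Δ t W (f : Fin Δ → Fin N) → (∀ u → W u ≡ true → degree W u < t) →
    (∀ i → W (f i) ≡ true) → count W ≤ commonBlueIn χ (tabulate W) f + Δ * t
  commonBlue-bound Δ t W f lowDegree fInW = begin
      count W
    ≡⟨ count-split W allBlue ⟩
      count (λ w → W w ∧ allBlue w) + count (λ w → W w ∧ not (allBlue w))
    ≤⟨ ℕP.+-mono-≤ (ℕP.≤-reflexive (sym (commonBlueIn-count W f))) (count-failing Δ _ W) ⟩
      commonBlueIn χ (tabulate W) f + sumFin (λ i → count (λ w → W w ∧ not (blue (f i) w)))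
    ≤⟨ ℕP.+-monoʳ-≤ _ (sumFin-mono (λ i → ℕP.≤-trans (nonBlue-≤ W (f i)) (lowDegree (f i) (fInW i)))) ⟩
      commonBlueIn χ (tabulate W) f + sumFin {Δ} (λ _ → t)
    ≡⟨ cong (commonBlueIn χ (tabulate W) f +_) (sumFin-const Δ t) ⟩
      commonBlueIn χ (tabulate W) f + Δ * t
    ∎
    where
    open ℕP.≤-Reasoning
    allBlue : Fin N → Bool
    allBlue = allOf (λ i → blue (f i))

open Rational

BlueDenseSubset : ∀ {N} → EdgeColouring N → Subset N → (Δ n : ℕ) → ℚ → Set
BlueDenseSubset {N} χ W Δ n ε = Σ (Subset N) λ W′ →
  W′ ⊆ W
  × (1ℚ ℚ.- ε) ℚ.* ℕ→ℚ ∣ W ∣ ℚ.≤ ℕ→ℚ ∣ W′ ∣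
  × (∀ (f : Fin Δ → Fin N) → Injective _≡_ _≡_ f → (∀ i → f i ∈ W′) →
       ℕ→ℚ ∣ W′ ∣ ℚ.- ℕ→ℚ Δ ℚ.* ε ℚ.* ℕ→ℚ n ℚ.≤ ℕ→ℚ (commonBlueIn χ W′ f))

peeledSubset : ∀ Δ (ε : ℚ) → 0ℚ ℚ.< ε → ∀ n {N} (χ : EdgeColouring N) (W : Fin N → Bool) d t → 1 ≤ d →
  (∀ D → RedBlue.CycleIn χ W D → length D ≤ suc d) →
  ℕ→ℚ d ℚ.≤ ε ℚ.* ℕ→ℚ t → ℕ→ℚ t ℚ.≤ ε ℚ.* ℕ→ℚ n →
  BlueDenseSubset χ (tabulate W) Δ n ε
peeledSubset Δ ε ε>0 n χ W d t 1≤d short d≤εt t≤εn = tabulate core , core⊆W , large , blueDense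
  where
  open RedBlue χ
  open Peeling (peel t W)

  fewRemoved : removed * t ≤ count W * d
  fewRemoved = ShortCycles.peeling-removes-few W d 1≤d short (peel t W)

  core⊆W : tabulate core ⊆ tabulate W
  core⊆W {x} x∈ = ∈-tabulate⁺ W (core⊆ x (∈-tabulate⁻ core x∈))

  large : (1ℚ ℚ.- ε) ℚ.* ℕ→ℚ ∣ tabulate W ∣ ℚ.≤ ℕ→ℚ ∣ tabulate core ∣
  large = subst₂ (λ a b → (1ℚ ℚ.- ε) ℚ.* ℕ→ℚ a ℚ.≤ ℕ→ℚ b) (sym (∣tabulate∣ W)) (sym (∣tabulate∣ core))
    (kept-fraction ε>0 removed t (count W) d (count core) fewRemoved
                   (positive-if-above ε>0 d t 1≤d d≤εt) d≤εt count-removed)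

  blueDense : ∀ (f : Fin Δ → Fin _) → Injective _≡_ _≡_ f → (∀ i → f i ∈ tabulate core) →
    ℕ→ℚ ∣ tabulate core ∣ ℚ.- ℕ→ℚ Δ ℚ.* ε ℚ.* ℕ→ℚ n ℚ.≤ ℕ→ℚ (commonBlueIn χ (tabulate core) f)
  blueDense f _ f∈core =
    subst (λ a → ℕ→ℚ a ℚ.- ℕ→ℚ Δ ℚ.* ε ℚ.* ℕ→ℚ n ℚ.≤ ℕ→ℚ commonBlue) (sym (∣tabulate∣ core))
      (subtract-Δεn ε>0 n t (count core) commonBlue Δ
        (commonBlue-bound Δ t core f lowDegree (λ i → ∈-tabulate⁻ core (f∈core i))) t≤εn)
    where
    commonBlue : ℕ
    commonBlue = commonBlueIn χ (tabulate core) f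

-- The theorem for ε ≤ 1 and ε² n > 2: the red cycles left after the first r
-- have at most d + 1 < ε² n vertices, and t = ⌊ε n⌋ satisfies d ≤ ε t.
blueDenseSubset : ∀ (Δ : ℕ) (ε : ℚ) → 0ℚ ℚ.< ε → ε ℚ.≤ 1ℚ → ∀ n → ℕ→ℚ 2 ℚ.< ε ℚ.* ε ℚ.* ℕ→ℚ n →
  ∀ {N} (χ : EdgeColouring N) Cs → OrderedDLC (Red χ) [] Cs → Exhaustive (Red χ) Cs → ∀ r →
  (∀ C rest → drop r Cs ≡ C ∷ rest → ¬ (ε ℚ.* ε ℚ.* ℕ→ℚ n ℚ.≤ ℕ→ℚ (length C))) →
  BlueDenseSubset χ (complementOf (concat (take r Cs))) Δ n ε
blueDenseSubset Δ ε ε>0 ε≤1 n ε²n>2 χ Cs ordered exhaustive r nextShort =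
  conclude (RedBlue.remainingCyclesShort χ (ε ℚ.* ε ℚ.* ℕ→ℚ n) Cs r ordered exhaustive nextShort ε²n>2)
           (integerPart (ε ℚ.* ℕ→ℚ n) n (εn-range ε>0 ε≤1 n))
  where
  W : Fin _ → Bool
  W = RedBlue.outside χ (concat (take r Cs))
  conclude : RedBlue.CycleBound χ W (ε ℚ.* ε ℚ.* ℕ→ℚ n) → IntegerPart (ε ℚ.* ℕ→ℚ n) →
    BlueDenseSubset χ (tabulate W) Δ n ε
  conclude (d , 1≤d , short , d+1<ε²n) (t , t≤εn , εn<t+1) =
    peeledSubset Δ ε ε>0 n χ W d t 1≤d short (≤ε-multiple ε>0 ε≤1 n t d εn<t+1 d+1<ε²n) t≤εn

-- The theorem: n₀ is chosen with ε² n₀ > 2, and ε ≤ 1 follows from ε Δ⁵ ≤ 1.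
lemma3 : (Δ : ℕ) → 3 ≤ Δ → (ε : ℚ) → 0ℚ ℚ.< ε → ε ℚ.* ℕ→ℚ (Δ ^ 5) ℚ.≤ 1ℚ →
    Σ ℕ λ n₀ → ∀ n → n₀ ≤ n →
    (G : Graph n) → MaxDegreeAtMost G Δ →
    (k σ : ℕ) → IsChromaticNumber G k → IsSigma G k σ →
    (χ : EdgeColouring (ramseyN Δ n k σ ε)) →
    (Cs : List (List (Fin (ramseyN Δ n k σ ε)))) →
    OrderedDLC (Red χ) [] Cs → Exhaustive (Red χ) Cs →
    (r : ℕ) → r ≤ length Cs →
    All (λ C → ε ℚ.* ε ℚ.* ℕ→ℚ n ℚ.≤ ℕ→ℚ (length C)) (take r Cs) →
    (∀ C rest → drop r Cs ≡ C ∷ rest → ¬ (ε ℚ.* ε ℚ.* ℕ→ℚ n ℚ.≤ ℕ→ℚ (length C))) →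
    Σ (Subset (ramseyN Δ n k σ ε)) λ W′ →
      W′ ⊆ complementOf (concat (take r Cs))
      × (1ℚ ℚ.- ε) ℚ.* ℕ→ℚ ∣ complementOf (concat (take r Cs)) ∣ ℚ.≤ ℕ→ℚ ∣ W′ ∣
      × (∀ (f : Fin Δ → Fin (ramseyN Δ n k σ ε)) → Injective _≡_ _≡_ f → (∀ i → f i ∈ W′) →
           ℕ→ℚ ∣ W′ ∣ ℚ.- ℕ→ℚ Δ ℚ.* ε ℚ.* ℕ→ℚ n ℚ.≤ ℕ→ℚ (commonBlueIn χ W′ f))
lemma3 Δ 3≤Δ ε ε>0 εΔ⁵≤1 =
  n₀ , λ n n₀≤n _ _ _ _ _ _ χ Cs ordered exhaustive r _ _ nextShort →
    blueDenseSubset Δ ε ε>0 ε≤1 n (ε²n>2 n n₀≤n) χ Cs ordered exhaustive r nextShort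
  where
  n₀ : ℕ
  n₀ = proj₁ (eventually-ε²n>2 ε>0)
  ε²n>2 : ∀ n → n₀ ≤ n → ℕ→ℚ 2 ℚ.< ε ℚ.* ε ℚ.* ℕ→ℚ n
  ε²n>2 = proj₂ (eventually-ε²n>2 ε>0)

  ε≤1 : ε ℚ.≤ 1ℚ
  ε≤1 = ≤1-if-multiple≤1 ε>0 (Δ ^ 5) εΔ⁵≤1 (ℕP.m^n>0 Δ {{ℕ.>-nonZero (ℕP.≤-trans (s≤s z≤n) 3≤Δ)}} 5)
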